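{- For all integers $p\geq 2$ with $p\neq 4$ and all integers $m\geq 2$, $D(C(m,p))=m+1$.
   Context: For integers $m\geq 1$, $p\geq 2$ with $n=mp\geq 3$, $C(m,p)$ is the graph with vertex set $\{0,1,\dots,n-1\}$ in which $i$ and $j$ are adjacent iff $j-i \bmod n$ belongs to $A=\{p-1+rp,\ p+1+rp : 0\leq r\leq m-1\}\subset\mathbb{Z}_n$. For a graph $G$, an $r$-labeling $c:V(G)\to\{1,\dots,r\}$ is $r$-distinguishing if for every automorphism $\sigma\neq \mathrm{id}$ of $G$ we have $c\neq c\circ\sigma$; the distinguishing number $D(G)$ is the smallest $r$ such that $G$ has an $r$-distinguishing labeling. -}

module Defs where

open import Data.Nat using (ℕ; zero; suc; _+_; _*_; _∸_; _<_; _%_; NonZero)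
open import Data.Fin using (Fin; toℕ)
open import Data.Product using (Σ; ∃; ∃-syntax; _×_; _,_)
open import Data.Sum using (_⊎_)
open import Relation.Binary.PropositionalEquality using (_≡_)
open import Relation.Nullary using (¬_)

Graph : ℕ → Set₁
Graph n = Fin n → Fin n → Set

record Automorphism {n : ℕ} (G : Graph n) : Set where
  field
    σ       : Fin n → Fin n
    σ⁻¹     : Fin n → Fin n
    left    : ∀ i → σ⁻¹ (σ i) ≡ i
    right   : ∀ i → σ (σ⁻¹ i) ≡ i
    presAdj : ∀ i j → G i j → G (σ i) (σ j)
    reflAdj : ∀ i j → G (σ i) (σ j) → G i j

-- An r-labeling uses labels Fin r (standing for {1,…,r}).
-- c is r-distinguishing iff for every automorphism σ ≠ id, c ≠ c ∘ σ.
IsDistinguishing : {n : ℕ} (G : Graph n) (r : ℕ) → (Fin n → Fin r) → Set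
IsDistinguishing {n} G r c =
  (a : Automorphism G) →
  ¬ (∀ i → Automorphism.σ a i ≡ i) →
  ¬ (∀ i → c i ≡ c (Automorphism.σ a i))

HasDistinguishing : {n : ℕ} (G : Graph n) (r : ℕ) → Set
HasDistinguishing {n} G r = Σ (Fin n → Fin r) (IsDistinguishing G r)

DistinguishingNumberIs : {n : ℕ} (G : Graph n) (d : ℕ) → Set
DistinguishingNumberIs G d =
  HasDistinguishing G d × (∀ r → r < d → ¬ HasDistinguishing G r)

-- The graph C(m,p) on Z_n, n = m*p: i ~ j iff (j - i) mod n lies in
-- A = { p-1+rp , p+1+rp : 0 ≤ r ≤ m-1 } ⊂ Z_n (elements of A reduced mod n).
C : (m p : ℕ) → .{{NonZero (m * p)}} → Graph (m * p)
C m p i j =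
  ∃[ r ] (r < m ×
    (((toℕ j + (m * p ∸ toℕ i)) % (m * p) ≡ (p ∸ 1 + r * p) % (m * p))
     ⊎ ((toℕ j + (m * p ∸ toℕ i)) % (m * p) ≡ (p + 1 + r * p) % (m * p))))

module Submission where

-- C(m,p) is the blow-up of the cycle Cₚ: vertex v lies in the fibre v mod p, each fibre is an
-- independent set of m vertices, and adjacency only depends on the fibres. Two vertices of a
-- fibre are twins, so a distinguishing colouring is injective on every fibre; with m colours
-- it is then a bijection on each fibre, and rotating the fibres along the cycle while keeping
-- colours is a nontrivial colour-preserving automorphism. Hence D ≥ m + 1. For p ≠ 4 distinct
-- vertices of Cₚ have distinct neighbourhoods, so every automorphism permutes the fibres; the
-- colouring below pins fibres 0 and 1, hence by walking along the cycle every fibre, and it is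
-- injective on each fibre, so it is distinguishing with m + 1 colours.

open import Defs
open import Data.Nat using (ℕ; _*_; _+_; _≤_; NonZero; zero; suc; _∸_; _<_; _%_; _/_; z≤n; s≤s)
open import Data.Nat.Properties
open import Data.Nat.DivMod
open import Data.Nat.Divisibility using (_∣_; divides; ∣-refl; 1∣_; 0∣⇒≡0; ∣⇒≤; m∣m*n)
open import Data.Nat.Tactic.RingSolver using (solve-∀)
open import Data.Fin as Fin using (Fin; toℕ; fromℕ<; combine; quotient; remainder; punchOut)
open import Data.Fin.Properties
  using (toℕ-injective; toℕ<n; toℕ-fromℕ<; toℕ-fromℕ; remQuot-combine; combine-remQuot; toℕ-combine;
         combine-injective; any?; injective⇒≤; punchOut-injective; ¬∀⟶∃¬)
open import Data.Fin.Permutation.Components using (transpose; transpose-inverse)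
open import Data.Product using (∃; _×_; _,_; proj₁; proj₂)
open import Data.Sum using (_⊎_; inj₁; inj₂)
open import Function.Base using (_∘_)
open import Function.Construct.Composition using (_⇔-∘_)
open import Function.Bundles using (_⇔_; mk⇔; Equivalence)
open import Function.Definitions using (Injective)
open import Relation.Nullary using (¬_; Dec; yes; no; contradiction)
open import Relation.Nullary.Decidable using (dec-true; _⊎-dec_)
open import Relation.Binary.PropositionalEquality

open Equivalence using (to; from)

transpose-matchˡ : ∀ {n} (i j : Fin n) → transpose i j i ≡ j
transpose-matchˡ i j rewrite dec-true (i Fin.≟ i) refl = refl

transpose-preserves : ∀ {n} {A : Set} (f : Fin n → A) {i j} →
                      f i ≡ f j → ∀ k → f (transpose i j k) ≡ f k
transpose-preserves f {i} {j} fi≡fj k with k Fin.≟ i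
... | yes refl = sym fi≡fj
... | no _ with k Fin.≟ j
...   | yes refl = fi≡fj
...   | no _ = refl

injective⇒surjective : ∀ {n} {f : Fin n → Fin n} →
                       Injective _≡_ _≡_ f → ∀ y → ∃ λ x → f x ≡ y
injective⇒surjective {suc n} {f} f-inj y with any? (λ x → f x Fin.≟ y)
... | yes found = found
... | no ¬found = contradiction (injective⇒≤ punched-injective) 1+n≰n
  where
  y≢f : ∀ x → y ≢ f x
  y≢f x y≡fx = ¬found (x , sym y≡fx)

  punched-injective : Injective _≡_ _≡_ (λ x → punchOut (y≢f x))
  punched-injective eq = f-inj (punchOut-injective (y≢f _) (y≢f _) eq)

remainder-combine : ∀ {m p} (t : Fin m) (k : Fin p) → remainder {m} p (combine t k) ≡ k
remainder-combine t k = cong proj₂ (remQuot-combine t k)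

quotient-combine : ∀ {m p} (t : Fin m) (k : Fin p) → quotient {m} p (combine t k) ≡ t
quotient-combine t k = cong proj₁ (remQuot-combine t k)

combine-quotient-remainder : ∀ {m p} (v : Fin (m * p)) →
                             combine (quotient {m} p v) (remainder {m} p v) ≡ v
combine-quotient-remainder {m} {p} v = combine-remQuot {m} p v

toℕ-remainder : ∀ {m p} .{{_ : NonZero p}} (v : Fin (m * p)) →
                toℕ (remainder {m} p v) ≡ toℕ v % p
toℕ-remainder {m} {p} v = begin
  toℕ r                    ≡⟨ m<n⇒m%n≡m (toℕ<n r) ⟨
  toℕ r % p                ≡⟨ %-remove-+ˡ (toℕ r) (m∣m*n (toℕ (quotient {m} p v))) ⟨
  (p * toℕ (quotient {m} p v) + toℕ r) % p
    ≡⟨ cong (_% p) (toℕ-combine (quotient {m} p v) r) ⟨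
  toℕ (combine (quotient {m} p v) r) % p
    ≡⟨ cong (λ w → toℕ w % p) (combine-quotient-remainder {m} v) ⟩
  toℕ v % p                ∎
  where
  open ≡-Reasoning
  r = remainder {m} p v

module _ {n} {G : Graph n} where

  identity : Automorphism G
  identity = record
    { σ = λ i → i ; σ⁻¹ = λ i → i ; left = λ _ → refl ; right = λ _ → refl
    ; presAdj = λ _ _ h → h ; reflAdj = λ _ _ h → h }

  inverse : Automorphism G → Automorphism G
  inverse a = record
    { σ = σ⁻¹ ; σ⁻¹ = σ ; left = right ; right = left
    ; presAdj = λ i j h → reflAdj (σ⁻¹ i) (σ⁻¹ j) (subst₂ G (sym (right i)) (sym (right j)) h)
    ; reflAdj = λ i j h → subst₂ G (right i) (right j) (presAdj (σ⁻¹ i) (σ⁻¹ j) h) }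
    where open Automorphism a

TwinFree : ∀ {p} → Graph p → Set
TwinFree H = ∀ {x y} → x ≢ y → ∃ λ z → (H x z × ¬ H y z) ⊎ (H y z × ¬ H x z)

-- Blow-ups of a graph by independent sets

module BlowUp {m-1 p : ℕ} (H : Graph p) (G : Graph (suc m-1 * p))
              (G⇔H : ∀ i j → G i j ⇔ H (remainder {suc m-1} p i) (remainder {suc m-1} p j)) where

  m : ℕ
  m = suc m-1

  V : Set
  V = Fin (m * p)

  fibre : V → Fin p
  fibre = remainder {m} p

  level : V → Fin m
  level = quotient {m} p

  vertex : Fin m → Fin p → V
  vertex = combine

  fibre-vertex : ∀ t k → fibre (vertex t k) ≡ k
  fibre-vertex = remainder-combine

  level-vertex : ∀ t k → level (vertex t k) ≡ t
  level-vertex = quotient-combine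

  vertex-level-fibre : ∀ v → vertex (level v) (fibre v) ≡ v
  vertex-level-fibre = combine-quotient-remainder {m}

  fibre-level-injective : ∀ {u v} → fibre u ≡ fibre v → level u ≡ level v → u ≡ v
  fibre-level-injective {u} {v} fu≡fv lu≡lv = begin
    u                          ≡⟨ vertex-level-fibre u ⟨
    vertex (level u) (fibre u) ≡⟨ cong₂ vertex lu≡lv fu≡fv ⟩
    vertex (level v) (fibre v) ≡⟨ vertex-level-fibre v ⟩
    v                          ∎
    where open ≡-Reasoning

  lift : (π : Automorphism H) (σ σ⁻¹ : V → V) →
         (∀ i → σ⁻¹ (σ i) ≡ i) → (∀ i → σ (σ⁻¹ i) ≡ i) →
         (∀ v → fibre (σ v) ≡ Automorphism.σ π (fibre v)) → Automorphism G
  lift π f f⁻¹ left right over = record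
    { σ = f ; σ⁻¹ = f⁻¹ ; left = left ; right = right
    ; presAdj = λ i j h → from (G⇔H (f i) (f j))
        (subst₂ H (sym (over i)) (sym (over j)) (π.presAdj (fibre i) (fibre j) (to (G⇔H i j) h)))
    ; reflAdj = λ i j h → from (G⇔H i j)
        (π.reflAdj (fibre i) (fibre j) (subst₂ H (over i) (over j) (to (G⇔H (f i) (f j)) h))) }
    where module π = Automorphism π

  swap : ∀ u v → fibre u ≡ fibre v → Automorphism G
  swap u v fu≡fv =
    lift identity (transpose u v) (transpose v u) (λ _ → transpose-inverse v u)
      (λ _ → transpose-inverse u v) (transpose-preserves fibre fu≡fv)

  distinguishing⇒injective-on-fibres : ∀ {r} {c : V → Fin r} → IsDistinguishing G r c →
    ∀ k → Injective _≡_ _≡_ (λ t → c (vertex t k))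
  distinguishing⇒injective-on-fibres {c = c} dist k {t} {t′} ct≡ct′ with t Fin.≟ t′
  ... | yes t≡t′ = t≡t′
  ... | no t≢t′ = contradiction (λ w → sym (transpose-preserves c ct≡ct′ w)) (dist σ nontrivial)
    where
    u = vertex t k
    σ = swap u (vertex t′ k) (trans (fibre-vertex t k) (sym (fibre-vertex t′ k)))
    nontrivial : ¬ (∀ w → transpose u (vertex t′ k) w ≡ w)
    nontrivial fixed = t≢t′ (sym (proj₁ (combine-injective t′ k t k
      (trans (sym (transpose-matchˡ u (vertex t′ k))) (fixed u)))))

  -- A colouring with m colours that is injective on every fibre is a bijection on each of
  -- them, so π lifts by sending each vertex to the vertex of the same colour in the image fibre.
  module Rotation (π : Automorphism H) (c : V → Fin m)
                  (c-inj : ∀ k → Injective _≡_ _≡_ (λ t → c (vertex t k))) where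
    open Automorphism π renaming (σ to π⁺; σ⁻¹ to π⁻)

    level-of-colour : Fin p → Fin m → Fin m
    level-of-colour k ℓ = proj₁ (injective⇒surjective (c-inj k) ℓ)

    colour-level-of-colour : ∀ k ℓ → c (vertex (level-of-colour k ℓ) k) ≡ ℓ
    colour-level-of-colour k ℓ = proj₂ (injective⇒surjective (c-inj k) ℓ)

    move : (Fin p → Fin p) → V → V
    move f v = vertex (level-of-colour (f (fibre v)) (c v)) (f (fibre v))

    fibre-move : ∀ f v → fibre (move f v) ≡ f (fibre v)
    fibre-move f v = fibre-vertex (level-of-colour (f (fibre v)) (c v)) (f (fibre v))

    colour-move : ∀ f v → c (move f v) ≡ c v
    colour-move f v = colour-level-of-colour (f (fibre v)) (c v)

    same-fibre-same-colour : ∀ {u v} → fibre u ≡ fibre v → c u ≡ c v → u ≡ v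
    same-fibre-same-colour {u} {v} fu≡fv cu≡cv = fibre-level-injective fu≡fv level≡
      where
      open ≡-Reasoning
      level≡ : level u ≡ level v
      level≡ = c-inj (fibre v) (begin
        c (vertex (level u) (fibre v)) ≡⟨ cong (λ k → c (vertex (level u) k)) fu≡fv ⟨
        c (vertex (level u) (fibre u)) ≡⟨ cong c (vertex-level-fibre u) ⟩
        c u                             ≡⟨ cu≡cv ⟩
        c v                             ≡⟨ cong c (vertex-level-fibre v) ⟨
        c (vertex (level v) (fibre v)) ∎)

    move-inverse : ∀ f g → (∀ k → g (f k) ≡ k) → ∀ v → move g (move f v) ≡ v
    move-inverse f g gf v = same-fibre-same-colour
      (trans (fibre-move g (move f v)) (trans (cong g (fibre-move f v)) (gf (fibre v))))
      (trans (colour-move g (move f v)) (colour-move f v))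

    rotation : Automorphism G
    rotation = lift π (move π⁺) (move π⁻) (move-inverse π⁺ π⁻ left) (move-inverse π⁻ π⁺ right) (fibre-move π⁺)

    rotation-preserves-colours : ∀ v → c v ≡ c (move π⁺ v)
    rotation-preserves-colours v = sym (colour-move π⁺ v)

    rotation-nontrivial : ¬ (∀ k → π⁺ k ≡ k) → ¬ (∀ v → move π⁺ v ≡ v)
    rotation-nontrivial π-moves fixed = π-moves λ k → begin
      π⁺ k                               ≡⟨ cong π⁺ (fibre-vertex Fin.zero k) ⟨
      π⁺ (fibre (vertex Fin.zero k))      ≡⟨ fibre-move π⁺ (vertex Fin.zero k) ⟨
      fibre (move π⁺ (vertex Fin.zero k)) ≡⟨ cong fibre (fixed (vertex Fin.zero k)) ⟩
      fibre (vertex Fin.zero k)           ≡⟨ fibre-vertex Fin.zero k ⟩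
      k                                   ∎
      where open ≡-Reasoning

  bijective-colouring-not-distinguishing : (π : Automorphism H) →
    ¬ (∀ k → Automorphism.σ π k ≡ k) → (c : V → Fin m) → ¬ IsDistinguishing G m c
  bijective-colouring-not-distinguishing π π-moves c dist =
    dist rotation (rotation-nontrivial π-moves) rotation-preserves-colours
    where open Rotation π c (distinguishing⇒injective-on-fibres dist)

  no-distinguishing-below : (π : Automorphism H) → ¬ (∀ k → Automorphism.σ π k ≡ k) →
    ∀ r → r < m + 1 → ¬ HasDistinguishing G r
  no-distinguishing-below π π-moves r r<m+1 (c , dist) =
    uses-m-colours c dist (≤-antisym r≤m (injective⇒≤ (distinguishing⇒injective-on-fibres dist k)))
    where
    uses-m-colours : ∀ {r} (c : V → Fin r) → IsDistinguishing G r c → r ≢ m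
    uses-m-colours c dist refl = bijective-colouring-not-distinguishing π π-moves c dist
    r≤m : r ≤ m
    r≤m = m<1+n⇒m≤n (subst (r <_) (+-comm m 1) r<m+1)
    k : Fin p
    k = proj₁ (¬∀⟶∃¬ p _ (λ k → Automorphism.σ π k Fin.≟ k) π-moves)

  module _ (twin-free : TwinFree H) (a : Automorphism G) where
    open Automorphism a

    same-fibre-same-neighbours : ∀ {u v} z → fibre u ≡ fibre v →
                                 H (fibre (σ u)) z → H (fibre (σ v)) z
    same-fibre-same-neighbours {u} {v} z fu≡fv adj =
      subst (H (fibre (σ v))) (fibre-vertex Fin.zero z) (to (G⇔H (σ v) w) σv~w)
      where
      w : V
      w = vertex Fin.zero z
      σu~w : G (σ u) (σ (σ⁻¹ w))
      σu~w = subst (G (σ u)) (sym (right w))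
               (from (G⇔H (σ u) w) (subst (H (fibre (σ u))) (sym (fibre-vertex Fin.zero z)) adj))
      v~σ⁻¹w : G v (σ⁻¹ w)
      v~σ⁻¹w = from (G⇔H v (σ⁻¹ w))
                 (subst (λ k → H k (fibre (σ⁻¹ w))) fu≡fv (to (G⇔H u (σ⁻¹ w)) (reflAdj u (σ⁻¹ w) σu~w)))
      σv~w : G (σ v) w
      σv~w = subst (G (σ v)) (right w) (presAdj v (σ⁻¹ w) v~σ⁻¹w)

    automorphism-respects-fibres : ∀ {u v} → fibre u ≡ fibre v → fibre (σ u) ≡ fibre (σ v)
    automorphism-respects-fibres {u} {v} fu≡fv with fibre (σ u) Fin.≟ fibre (σ v)
    ... | yes same = same
    ... | no different with twin-free different
    ...   | z , inj₁ (adj , ¬adj) = contradiction (same-fibre-same-neighbours z fu≡fv adj) ¬adj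
    ...   | z , inj₂ (adj , ¬adj) = contradiction (same-fibre-same-neighbours z (sym fu≡fv) adj) ¬adj

-- Arithmetic modulo p

∣4⇒∣2 : ∀ {d} → d ≢ 4 → d ∣ 4 → d ∣ 2
∣4⇒∣2 {0} _ 0∣4 with () ← 0∣⇒≡0 0∣4
∣4⇒∣2 {1} _ _ = 1∣ 2
∣4⇒∣2 {2} _ _ = ∣-refl
∣4⇒∣2 {3} _ (divides (suc (suc q)) ())
∣4⇒∣2 {4} d≢4 _ = contradiction refl d≢4
∣4⇒∣2 {suc (suc (suc (suc (suc d))))} _ d∣4 with s≤s (s≤s (s≤s (s≤s ()))) ← ∣⇒≤ d∣4

module Modular (p : ℕ) .{{_ : NonZero p}} where

  [m%p+n]%p≡[m+n]%p : ∀ a b → (a % p + b) % p ≡ (a + b) % p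
  [m%p+n]%p≡[m+n]%p a b = begin
    (a % p + b) % p         ≡⟨ %-distribˡ-+ (a % p) b p ⟩
    (a % p % p + b % p) % p ≡⟨ cong (λ x → (x + b % p) % p) (m%n%n≡m%n a p) ⟩
    (a % p + b % p) % p     ≡⟨ %-distribˡ-+ a b p ⟨
    (a + b) % p             ∎
    where open ≡-Reasoning

  [m+n%p]%p≡[m+n]%p : ∀ a b → (a + b % p) % p ≡ (a + b) % p
  [m+n%p]%p≡[m+n]%p a b = begin
    (a + b % p) % p ≡⟨ cong (_% p) (+-comm a (b % p)) ⟩
    (b % p + a) % p ≡⟨ [m%p+n]%p≡[m+n]%p b a ⟩
    (b + a) % p     ≡⟨ cong (_% p) (+-comm b a) ⟩
    (a + b) % p     ∎
    where open ≡-Reasoning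

  [m+n+[p∸n%p]]%p≡m%p : ∀ a c → (a + c + (p ∸ c % p)) % p ≡ a % p
  [m+n+[p∸n%p]]%p≡m%p a c = begin
    (a + c + e) % p                   ≡⟨ cong (λ x → (a + x + e) % p) (m≡m%n+[m/n]*n c p) ⟩
    (a + (c % p + c / p * p) + e) % p ≡⟨ cong (_% p) (regroup a (c % p) (c / p * p) e) ⟩
    (a + (c % p + e) + c / p * p) % p ≡⟨ [m+kn]%n≡m%n (a + (c % p + e)) (c / p) p ⟩
    (a + (c % p + e)) % p             ≡⟨ cong (λ x → (a + x) % p) (m+[n∸m]≡n (m%n≤n c p)) ⟩
    (a + p) % p                       ≡⟨ [m+n]%n≡m%n a p ⟩
    a % p                             ∎
    where
    open ≡-Reasoning
    e = p ∸ c % p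
    regroup : ∀ a r q e → a + (r + q) + e ≡ a + (r + e) + q
    regroup = solve-∀

  +-cancelʳ-% : ∀ {a b} c → a < p → b < p → (a + c) % p ≡ (b + c) % p → a ≡ b
  +-cancelʳ-% {a} {b} c a<p b<p eq = begin
    a                         ≡⟨ m<n⇒m%n≡m a<p ⟨
    a % p                     ≡⟨ [m+n+[p∸n%p]]%p≡m%p a c ⟨
    (a + c + e) % p           ≡⟨ [m%p+n]%p≡[m+n]%p (a + c) e ⟨
    ((a + c) % p + e) % p     ≡⟨ cong (λ x → (x + e) % p) eq ⟩
    ((b + c) % p + e) % p     ≡⟨ [m%p+n]%p≡[m+n]%p (b + c) e ⟩
    (b + c + e) % p           ≡⟨ [m+n+[p∸n%p]]%p≡m%p b c ⟩
    b % p                     ≡⟨ m<n⇒m%n≡m b<p ⟩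
    b                         ∎
    where
    open ≡-Reasoning
    e = p ∸ c % p

  %-cong-∣ : ∀ {n} .{{_ : NonZero n}} x y → p ∣ n → x % n ≡ y % n → x % p ≡ y % p
  %-cong-∣ {n} x y p∣n eq = begin
    x % p     ≡⟨ m∣n⇒o%n%m≡o%m p n x p∣n ⟨
    x % n % p ≡⟨ cong (_% p) eq ⟩
    y % n % p ≡⟨ m∣n⇒o%n%m≡o%m p n y p∣n ⟩
    y % p     ∎
    where open ≡-Reasoning

module Cycle (p-2 : ℕ) where

  p : ℕ
  p = suc (suc p-2)

  open Modular p public

  next : ℕ → ℕ
  next a = suc a % p

  infix 4 _~_
  _~_ : ℕ → ℕ → Set
  a ~ b = b ≡ next a ⊎ a ≡ next b

  _~?_ : ∀ a b → Dec (a ~ b)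
  a ~? b = b ≟ next a ⊎-dec a ≟ next b

  next<p : ∀ a → next a < p
  next<p a = m%n<n (suc a) p

  next-injective : ∀ {a b} → a < p → b < p → next a ≡ next b → a ≡ b
  next-injective {a} {b} a<p b<p eq = +-cancelʳ-% 1 a<p b<p (begin
    (a + 1) % p ≡⟨ cong (_% p) (+-comm a 1) ⟩
    next a      ≡⟨ eq ⟩
    next b      ≡⟨ cong (_% p) (+-comm 1 b) ⟩
    (b + 1) % p ∎)
    where open ≡-Reasoning

  next-preserves-~ : ∀ {a b} → a ~ b → next a ~ next b
  next-preserves-~ (inj₁ b≡next-a) = inj₁ (cong next b≡next-a)
  next-preserves-~ (inj₂ a≡next-b) = inj₂ (cong next a≡next-b)

  next-reflects-~ : ∀ {a b} → a < p → b < p → next a ~ next b → a ~ b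
  next-reflects-~ {a} {b} a<p b<p (inj₁ eq) = inj₁ (next-injective b<p (next<p a) eq)
  next-reflects-~ {a} {b} a<p b<p (inj₂ eq) = inj₂ (next-injective a<p (next<p b) eq)

  next≡suc⇒≡ : ∀ {a k} → a < p → next a ≡ suc k → a ≡ k
  next≡suc⇒≡ {a} a<p eq with m≤n⇒m<n∨m≡n a<p
  ... | inj₁ 1+a<p = suc-injective (trans (sym (m<n⇒m%n≡m 1+a<p)) eq)
  ... | inj₂ 1+a≡p = contradiction (trans (sym (trans (cong (_% p) 1+a≡p) (n%n≡0 p))) eq) 0≢1+n

  next⁴ : ∀ a → next (next (next (next a))) ≡ (4 + a) % p
  next⁴ a = begin
    next (next (next (next a)))     ≡⟨ cong (λ x → next (next x)) (step 1) ⟩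
    next (next ((2 + a) % p))       ≡⟨ cong next (step 2) ⟩
    next ((3 + a) % p)              ≡⟨ step 3 ⟩
    (4 + a) % p                     ∎
    where
    open ≡-Reasoning
    step : ∀ k → next ((k + a) % p) ≡ (suc k + a) % p
    step k = [m+n%p]%p≡[m+n]%p 1 (k + a)

  next⁴-fixed⇒p∣4 : ∀ {a} → next (next (next (next a))) ≡ a → p ∣ 4
  next⁴-fixed⇒p∣4 {a} fixed = divides ((4 + a) / p) (+-cancelˡ-≡ a _ _ (begin
    a + 4                           ≡⟨ +-comm a 4 ⟩
    4 + a                           ≡⟨ m≡m%n+[m/n]*n (4 + a) p ⟩
    (4 + a) % p + (4 + a) / p * p   ≡⟨ cong (_+ (4 + a) / p * p) (trans (sym (next⁴ a)) fixed) ⟩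
    a + (4 + a) / p * p             ∎))
    where open ≡-Reasoning

  next²-fixed : p ≢ 4 → ∀ {a} → a < p → next (next (next (next a))) ≡ a → next (next a) ≡ a
  next²-fixed p≢4 {a} a<p fixed = begin
    next (next a) ≡⟨ [m+n%p]%p≡[m+n]%p 1 (1 + a) ⟩
    (2 + a) % p   ≡⟨ %-remove-+ˡ a (∣4⇒∣2 p≢4 (next⁴-fixed⇒p∣4 fixed)) ⟩
    a % p         ≡⟨ m<n⇒m%n≡m a<p ⟩
    a             ∎
    where open ≡-Reasoning

  -- If b ~ next a and a ~ next b, then b = next² a and a = next² b, so a = next⁴ a and p ∣ 4.
  ~-twin-free : p ≢ 4 → ∀ {a b} → a < p → b < p → a ≢ b →
                 ∃ λ z → z < p × ((a ~ z × ¬ b ~ z) ⊎ (b ~ z × ¬ a ~ z))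
  ~-twin-free p≢4 {a} {b} a<p b<p a≢b with b ~? next a
  ... | no b≁next-a = next a , next<p a , inj₁ (inj₁ refl , b≁next-a)
  ... | yes (inj₁ eq) = contradiction (next-injective a<p b<p eq) a≢b
  ... | yes (inj₂ b≡next²a) with a ~? next b
  ...   | no a≁next-b = next b , next<p b , inj₂ (inj₁ refl , a≁next-b)
  ...   | yes (inj₁ eq) = contradiction (next-injective a<p b<p (sym eq)) a≢b
  ...   | yes (inj₂ a≡next²b) = contradiction (sym (trans b≡next²a next²a≡a)) a≢b
    where
    next²a≡a : next (next a) ≡ a
    next²a≡a = next²-fixed p≢4 a<p (sym (trans a≡next²b (cong (λ x → next (next x)) b≡next²a)))

  shift-~ : ∀ {d a b} → d < p → a < p → b < p → (d + a) % p ≡ b → (d ≡ p ∸ 1 ⊎ d ≡ 1) ⇔ a ~ b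
  shift-~ {d} {a} {b} d<p a<p b<p shift = mk⇔ shift⇒~ ~⇒shift
    where
    open ≡-Reasoning
    shift⇒~ : d ≡ p ∸ 1 ⊎ d ≡ 1 → a ~ b
    shift⇒~ (inj₁ refl) = inj₂ (begin
      a                       ≡⟨ m<n⇒m%n≡m a<p ⟨
      a % p                   ≡⟨ [m+n]%n≡m%n a p ⟨
      (a + p) % p             ≡⟨ cong (_% p) (+-comm a p) ⟩
      (1 + (d + a)) % p       ≡⟨ [m+n%p]%p≡[m+n]%p 1 (d + a) ⟨
      next ((d + a) % p)      ≡⟨ cong next shift ⟩
      next b                  ∎)
    shift⇒~ (inj₂ refl) = inj₁ (sym shift)
    ~⇒shift : a ~ b → d ≡ p ∸ 1 ⊎ d ≡ 1
    ~⇒shift (inj₁ b≡next-a) = inj₂ (+-cancelʳ-% a d<p (s≤s (s≤s z≤n)) (trans shift b≡next-a))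
    ~⇒shift (inj₂ a≡next-b) = inj₁ (+-cancelʳ-% a d<p ≤-refl (begin
      (d + a) % p             ≡⟨ shift ⟩
      b                       ≡⟨ m<n⇒m%n≡m b<p ⟨
      b % p                   ≡⟨ [m+n]%n≡m%n b p ⟨
      (b + p) % p             ≡⟨ cong (_% p) (trans (+-comm b p) (sym (+-suc (p ∸ 1) b))) ⟩
      (p ∸ 1 + (1 + b)) % p   ≡⟨ [m+n%p]%p≡[m+n]%p (p ∸ 1) (1 + b) ⟨
      (p ∸ 1 + next b) % p    ≡⟨ cong (λ x → (p ∸ 1 + x) % p) a≡next-b ⟨
      (p ∸ 1 + a) % p         ∎))


module Circulant (m-1 p-2 : ℕ) where

  open Cycle p-2 public

  m : ℕ
  m = suc m-1

  n : ℕ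
  n = m * p

  residue : Fin n → ℕ
  residue v = toℕ (remainder {m} p v)

  residue<p : ∀ v → residue v < p
  residue<p v = toℕ<n (remainder {m} p v)

  offset : Fin n → Fin n → ℕ
  offset i j = toℕ j + (n ∸ toℕ i)

  p∣n : p ∣ n
  p∣n = divides m refl

  offset-shifts-residue : ∀ i j → (offset i j % p + residue i) % p ≡ residue j
  offset-shifts-residue i j = begin
    (offset i j % p + residue i) % p     ≡⟨ cong (λ x → (offset i j % p + x) % p) (toℕ-remainder {m} i) ⟩
    (offset i j % p + toℕ i % p) % p     ≡⟨ %-distribˡ-+ (offset i j) (toℕ i) p ⟨
    (offset i j + toℕ i) % p             ≡⟨ cong (_% p) (+-assoc (toℕ j) (n ∸ toℕ i) (toℕ i)) ⟩
    (toℕ j + (n ∸ toℕ i + toℕ i)) % p    ≡⟨ cong (λ x → (toℕ j + x) % p) (m∸n+n≡m (<⇒≤ (toℕ<n i))) ⟩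
    (toℕ j + n) % p                      ≡⟨ %-remove-+ʳ (toℕ j) p∣n ⟩
    toℕ j % p                            ≡⟨ toℕ-remainder {m} j ⟨
    residue j                            ∎
    where open ≡-Reasoning

  [x%n]/p<m : ∀ x → x % n / p < m
  [x%n]/p<m x = *-cancelʳ-< p _ m (begin-strict
    x % n / p * p             ≤⟨ m≤n+m _ (x % n % p) ⟩
    x % n % p + x % n / p * p ≡⟨ m≡m%n+[m/n]*n (x % n) p ⟨
    x % n                     <⟨ m%n<n x n ⟩
    m * p                     ∎)
    where open ≤-Reasoning

  %n≡%p+q*p : ∀ x → ∃ λ q → q < m × x % n ≡ x % p + q * p
  %n≡%p+q*p x = x % n / p , [x%n]/p<m x , (begin
    x % n                     ≡⟨ m≡m%n+[m/n]*n (x % n) p ⟩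
    x % n % p + x % n / p * p ≡⟨ cong (_+ x % n / p * p) (m∣n⇒o%n%m≡o%m p n x p∣n) ⟩
    x % p + x % n / p * p     ∎)
    where open ≡-Reasoning

  1+[p+x]≡p+1+x : ∀ x → 1 + (p + x) ≡ p + 1 + x
  1+[p+x]≡p+1+x x = cong (_+ x) (+-comm 1 p)

  reduce-mod-n : ∀ x {y} → x % n ≡ y → x % n ≡ y % n
  reduce-mod-n x eq = trans (sym (m%n%n≡m%n x n)) (cong (_% n) eq)

  C⇔offset : ∀ i j → C m p i j ⇔ (offset i j % p ≡ p ∸ 1 ⊎ offset i j % p ≡ 1)
  C⇔offset i j = mk⇔ C⇒offset offset⇒C
    where
    open ≡-Reasoning
    x = offset i j
    C⇒offset : C m p i j → x % p ≡ p ∸ 1 ⊎ x % p ≡ 1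
    C⇒offset (r , _ , inj₁ x≡) = inj₁ (begin
      x % p                     ≡⟨ %-cong-∣ x (p ∸ 1 + r * p) p∣n x≡ ⟩
      (p ∸ 1 + r * p) % p       ≡⟨ [m+kn]%n≡m%n (p ∸ 1) r p ⟩
      (p ∸ 1) % p               ≡⟨ m<n⇒m%n≡m ≤-refl ⟩
      p ∸ 1                     ∎)
    C⇒offset (r , _ , inj₂ x≡) = inj₂ (begin
      x % p                     ≡⟨ %-cong-∣ x (p + 1 + r * p) p∣n x≡ ⟩
      (p + 1 + r * p) % p       ≡⟨ [m+kn]%n≡m%n (p + 1) r p ⟩
      (p + 1) % p               ≡⟨ cong (_% p) (+-comm p 1) ⟩
      (1 + p) % p               ≡⟨ [m+n]%n≡m%n 1 p ⟩
      1                         ∎)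
    offset⇒C : x % p ≡ p ∸ 1 ⊎ x % p ≡ 1 → C m p i j
    offset⇒C (inj₁ x≡p-1) with q , q<m , x≡ ← %n≡%p+q*p x =
      q , q<m , inj₁ (reduce-mod-n x (trans x≡ (cong (_+ q * p) x≡p-1)))
    offset⇒C (inj₂ x≡1) with %n≡%p+q*p x
    ... | zero , _ , x≡ = m-1 , ≤-refl , inj₂ (begin
      x % n                     ≡⟨ trans x≡ (cong (_+ 0) x≡1) ⟩
      1                         ≡⟨ m<n⇒m%n≡m {n = n} (s≤s (s≤s z≤n)) ⟨
      1 % n                     ≡⟨ [m+n]%n≡m%n 1 n ⟨
      (1 + n) % n               ≡⟨ cong (_% n) (1+[p+x]≡p+1+x (m-1 * p)) ⟩
      (p + 1 + m-1 * p) % n     ∎)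
    ... | suc r , 1+r<m , x≡ = r , <-trans (n<1+n r) 1+r<m , inj₂ (reduce-mod-n x (begin
      x % n                     ≡⟨ x≡ ⟩
      x % p + suc r * p         ≡⟨ cong (_+ suc r * p) x≡1 ⟩
      1 + (p + r * p)           ≡⟨ 1+[p+x]≡p+1+x (r * p) ⟩
      p + 1 + r * p             ∎))

  C⇔~ : ∀ i j → C m p i j ⇔ residue i ~ residue j
  C⇔~ i j = shift-~ (m%n<n (offset i j) p) (residue<p i) (residue<p j) (offset-shifts-residue i j)
            ⇔-∘ C⇔offset i j

module CycleBlowUp (m-1 p-2 : ℕ) where

  open Circulant m-1 p-2 public

  Cₚ : Graph p
  Cₚ x y = toℕ x ~ toℕ y

  open BlowUp Cₚ (C m p) C⇔~ public hiding (m)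

  Cₚ-twin-free : p ≢ 4 → TwinFree Cₚ
  Cₚ-twin-free p≢4 {x} {y} x≢y
    with z , z<p , separated ← ~-twin-free p≢4 (toℕ<n x) (toℕ<n y) (x≢y ∘ toℕ-injective) =
    fromℕ< z<p , subst (λ z → (toℕ x ~ z × ¬ toℕ y ~ z) ⊎ (toℕ y ~ z × ¬ toℕ x ~ z))
                       (sym (toℕ-fromℕ< z<p)) separated

  rotate : Fin p → Fin p
  rotate k = fromℕ< (next<p (toℕ k))

  toℕ-rotate : ∀ k → toℕ (rotate k) ≡ next (toℕ k)
  toℕ-rotate k = toℕ-fromℕ< (next<p (toℕ k))

  unrotate : Fin p → Fin p
  unrotate k = fromℕ< (m%n<n (toℕ k + (p ∸ 1)) p)

  toℕ-unrotate : ∀ k → toℕ (unrotate k) ≡ (toℕ k + (p ∸ 1)) % p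
  toℕ-unrotate k = toℕ-fromℕ< (m%n<n (toℕ k + (p ∸ 1)) p)

  [k+1+[p∸1]]%p≡k : ∀ {k} → k < p → (k + 1 + (p ∸ 1)) % p ≡ k
  [k+1+[p∸1]]%p≡k {k} k<p = begin
    (k + 1 + (p ∸ 1)) % p ≡⟨ cong (_% p) (trans (+-assoc k 1 (p ∸ 1)) (+-comm k p)) ⟩
    (p + k) % p           ≡⟨ %-remove-+ˡ k ∣-refl ⟩
    k % p                 ≡⟨ m<n⇒m%n≡m k<p ⟩
    k                     ∎
    where open ≡-Reasoning

  rotate-unrotate : ∀ k → rotate (unrotate k) ≡ k
  rotate-unrotate k = toℕ-injective (begin
    toℕ (rotate (unrotate k))         ≡⟨ toℕ-rotate (unrotate k) ⟩
    next (toℕ (unrotate k))           ≡⟨ cong next (toℕ-unrotate k) ⟩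
    next ((toℕ k + (p ∸ 1)) % p)      ≡⟨ [m+n%p]%p≡[m+n]%p 1 (toℕ k + (p ∸ 1)) ⟩
    (1 + (toℕ k + (p ∸ 1))) % p       ≡⟨ cong (_% p) (sym (+-assoc 1 (toℕ k) (p ∸ 1))) ⟩
    (1 + toℕ k + (p ∸ 1)) % p         ≡⟨ cong (λ x → (x + (p ∸ 1)) % p) (+-comm 1 (toℕ k)) ⟩
    (toℕ k + 1 + (p ∸ 1)) % p         ≡⟨ [k+1+[p∸1]]%p≡k (toℕ<n k) ⟩
    toℕ k                             ∎)
    where open ≡-Reasoning

  unrotate-rotate : ∀ k → unrotate (rotate k) ≡ k
  unrotate-rotate k = toℕ-injective (begin
    toℕ (unrotate (rotate k))         ≡⟨ toℕ-unrotate (rotate k) ⟩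
    (toℕ (rotate k) + (p ∸ 1)) % p    ≡⟨ cong (λ x → (x + (p ∸ 1)) % p) (toℕ-rotate k) ⟩
    (next (toℕ k) + (p ∸ 1)) % p      ≡⟨ [m%p+n]%p≡[m+n]%p (1 + toℕ k) (p ∸ 1) ⟩
    (1 + toℕ k + (p ∸ 1)) % p         ≡⟨ cong (λ x → (x + (p ∸ 1)) % p) (+-comm 1 (toℕ k)) ⟩
    (toℕ k + 1 + (p ∸ 1)) % p         ≡⟨ [k+1+[p∸1]]%p≡k (toℕ<n k) ⟩
    toℕ k                             ∎)
    where open ≡-Reasoning

  rotation-of-Cₚ : Automorphism Cₚ
  rotation-of-Cₚ = record
    { σ = rotate ; σ⁻¹ = unrotate ; left = unrotate-rotate ; right = rotate-unrotate
    ; presAdj = λ x y x~y → subst₂ _~_ (sym (toℕ-rotate x)) (sym (toℕ-rotate y)) (next-preserves-~ x~y)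
    ; reflAdj = λ x y x~y → next-reflects-~ (toℕ<n x) (toℕ<n y)
                              (subst₂ _~_ (toℕ-rotate x) (toℕ-rotate y) x~y) }

  rotate-moves : ¬ (∀ k → rotate k ≡ k)
  rotate-moves fixed = 0≢1+n (sym (trans (sym (toℕ-rotate Fin.zero)) (cong toℕ (fixed Fin.zero))))

-- Fibre 0 gets the colours 1, …, m, fibre 1 the colours 0, m, 2, …, m - 1, and every
-- other fibre 0, …, m - 1. Colour m then occurs only in fibres 0 and 1, colour 1 not in
-- fibre 1 and colour 0 not in fibre 0, which pins these two fibres.
module DistinguishingColouring (m-2 p-2 : ℕ) (p≢4 : suc (suc p-2) ≢ 4) where

  open CycleBlowUp (suc m-2) p-2 public

  label : ℕ → ℕ → ℕ
  label 0 t = suc t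
  label 1 0 = 0
  label 1 1 = m
  label 1 (suc (suc t)) = suc (suc t)
  label (suc (suc k)) t = t

  label≤m : ∀ k {t} → t < m → label k t ≤ m
  label≤m 0 t<m = t<m
  label≤m 1 {0} _ = z≤n
  label≤m 1 {1} _ = ≤-refl
  label≤m 1 {suc (suc t)} t<m = <⇒≤ t<m
  label≤m (suc (suc k)) t<m = <⇒≤ t<m

  label-injective : ∀ k {t t′} → t < m → t′ < m → label k t ≡ label k t′ → t ≡ t′
  label-injective 0 _ _ eq = suc-injective eq
  label-injective 1 {0} {0} _ _ _ = refl
  label-injective 1 {0} {1} _ _ ()
  label-injective 1 {0} {suc (suc t′)} _ _ ()
  label-injective 1 {1} {0} _ _ ()
  label-injective 1 {suc (suc t)} {0} _ _ ()
  label-injective 1 {1} {1} _ _ _ = refl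
  label-injective 1 {1} {suc (suc t′)} _ t′<m eq = contradiction (sym eq) (<⇒≢ t′<m)
  label-injective 1 {suc (suc t)} {1} t<m _ eq = contradiction eq (<⇒≢ t<m)
  label-injective 1 {suc (suc t)} {suc (suc t′)} _ _ eq = eq
  label-injective (suc (suc k)) _ _ eq = eq

  label≡m⇒k≤1 : ∀ k {t} → t < m → label k t ≡ m → k ≡ 0 ⊎ k ≡ 1
  label≡m⇒k≤1 0 _ _ = inj₁ refl
  label≡m⇒k≤1 1 _ _ = inj₂ refl
  label≡m⇒k≤1 (suc (suc k)) t<m eq = contradiction eq (<⇒≢ t<m)

  label≡1⇒k≢1 : ∀ k t → label k t ≡ 1 → k ≢ 1
  label≡1⇒k≢1 1 (suc (suc t)) () refl

  label≡0⇒k≢0 : ∀ k t → label k t ≡ 0 → k ≢ 0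
  label≡0⇒k≢0 0 t () refl

  labelOf : V → ℕ
  labelOf v = label (residue v) (toℕ (level v))

  labelOf<m+1 : ∀ v → labelOf v < m + 1
  labelOf<m+1 v = subst (labelOf v <_) (+-comm 1 m) (s≤s (label≤m (residue v) (toℕ<n (level v))))

  colouring : V → Fin (m + 1)
  colouring v = fromℕ< (labelOf<m+1 v)

  labelOf-vertex : ∀ t k → labelOf (vertex t k) ≡ label (toℕ k) (toℕ t)
  labelOf-vertex t k =
    cong₂ label (cong toℕ (fibre-vertex t k)) (cong toℕ (level-vertex t k))

  ColourPreserving : Automorphism (C m p) → Set
  ColourPreserving a = ∀ v → colouring v ≡ colouring (Automorphism.σ a v)

  inverse-colour-preserving : ∀ a → ColourPreserving a → ColourPreserving (inverse a)
  inverse-colour-preserving a preserving v =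
    sym (trans (preserving (σ⁻¹ v)) (cong colouring (right v)))
    where open Automorphism a

  FixesResidue : ℕ → Set
  FixesResidue k = ∀ a → ColourPreserving a → ∀ v → residue v ≡ k → residue (Automorphism.σ a v) ≡ k

  module _ (a : Automorphism (C m p)) (preserving : ColourPreserving a) where
    open Automorphism a

    labelOf-σ : ∀ v → labelOf (σ v) ≡ labelOf v
    labelOf-σ v = begin
      labelOf (σ v)            ≡⟨ toℕ-fromℕ< (labelOf<m+1 (σ v)) ⟨
      toℕ (colouring (σ v))    ≡⟨ cong toℕ (preserving v) ⟨
      toℕ (colouring v)        ≡⟨ toℕ-fromℕ< (labelOf<m+1 v) ⟩
      labelOf v                ∎
      where open ≡-Reasoning

    σ-respects-residues : ∀ {u v} → residue u ≡ residue v → residue (σ u) ≡ residue (σ v)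
    σ-respects-residues =
      cong toℕ ∘ automorphism-respects-fibres (Cₚ-twin-free p≢4) a ∘ toℕ-injective

    residue-σ-of-colour-m : ∀ v → labelOf v ≡ m → residue (σ v) ≡ 0 ⊎ residue (σ v) ≡ 1
    residue-σ-of-colour-m v ≡m =
      label≡m⇒k≤1 (residue (σ v)) (toℕ<n (level (σ v))) (trans (labelOf-σ v) ≡m)

    fixes-residue-0 : ∀ v → residue v ≡ 0 → residue (σ v) ≡ 0
    fixes-residue-0 v v∈0 = trans (σ-respects-residues (trans v∈0 (sym top∈0))) top↦0
      where
      top bottom : V
      top = vertex (Fin.fromℕ (suc m-2)) Fin.zero
      bottom = vertex Fin.zero Fin.zero
      top∈0 : residue top ≡ 0
      top∈0 = cong toℕ (fibre-vertex (Fin.fromℕ (suc m-2)) Fin.zero)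
      bottom∉1 : residue (σ bottom) ≢ 1
      bottom∉1 = label≡1⇒k≢1 _ _ (trans (labelOf-σ bottom) (labelOf-vertex Fin.zero Fin.zero))
      top↦0 : residue (σ top) ≡ 0
      top↦0 with residue-σ-of-colour-m top
                   (trans (labelOf-vertex (Fin.fromℕ (suc m-2)) Fin.zero) (cong suc (toℕ-fromℕ (suc m-2))))
      ... | inj₁ σtop∈0 = σtop∈0
      ... | inj₂ σtop∈1 = contradiction (trans (σ-respects-residues (sym top∈0)) σtop∈1) bottom∉1

    fixes-residue-1 : ∀ v → residue v ≡ 1 → residue (σ v) ≡ 1
    fixes-residue-1 v v∈1 = trans (σ-respects-residues (trans v∈1 (sym top∈1))) top↦1
      where
      top bottom : V
      top = vertex (Fin.suc Fin.zero) (Fin.suc Fin.zero)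
      bottom = vertex Fin.zero (Fin.suc Fin.zero)
      top∈1 : residue top ≡ 1
      top∈1 = cong toℕ (fibre-vertex (Fin.suc Fin.zero) (Fin.suc Fin.zero))
      bottom∉0 : residue (σ bottom) ≢ 0
      bottom∉0 = label≡0⇒k≢0 _ _ (trans (labelOf-σ bottom) (labelOf-vertex Fin.zero (Fin.suc Fin.zero)))
      top↦1 : residue (σ top) ≡ 1
      top↦1 with residue-σ-of-colour-m top (labelOf-vertex (Fin.suc Fin.zero) (Fin.suc Fin.zero))
      ... | inj₂ σtop∈1 = σtop∈1
      ... | inj₁ σtop∈0 = contradiction (trans (σ-respects-residues (sym top∈1)) σtop∈0) bottom∉0

  -- Fibre k + 2 is the neighbour of fibre k + 1 other than fibre k.
  fixes-residue-+2 : ∀ {k} → FixesResidue k → FixesResidue (suc k) → suc (suc k) < p →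
                     FixesResidue (suc (suc k))
  fixes-residue-+2 {k} fixes-k fixes-k+1 k+2<p a preserving v v∈k+2 =
    σw~σv⇒σv∈k+2 (to (C⇔~ (σ w) (σ v)) (presAdj w v (from (C⇔~ w v) w~v)))
    where
    open Automorphism a
    k+1<p : suc k < p
    k+1<p = <-trans (n<1+n (suc k)) k+2<p
    w : V
    w = vertex Fin.zero (fromℕ< k+1<p)
    w∈k+1 : residue w ≡ suc k
    w∈k+1 = trans (cong toℕ (fibre-vertex Fin.zero (fromℕ< k+1<p))) (toℕ-fromℕ< k+1<p)
    next[k+1]≡k+2 : next (suc k) ≡ suc (suc k)
    next[k+1]≡k+2 = m<n⇒m%n≡m k+2<p
    w~v : residue w ~ residue v
    w~v = inj₁ (trans v∈k+2 (trans (sym next[k+1]≡k+2) (cong next (sym w∈k+1))))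
    σw∈k+1 : residue (σ w) ≡ suc k
    σw∈k+1 = fixes-k+1 a preserving w w∈k+1
    σw~σv⇒σv∈k+2 : residue (σ w) ~ residue (σ v) → residue (σ v) ≡ suc (suc k)
    σw~σv⇒σv∈k+2 (inj₁ σv≡next-σw) = trans σv≡next-σw (trans (cong next σw∈k+1) next[k+1]≡k+2)
    σw~σv⇒σv∈k+2 (inj₂ σw≡next-σv) = contradiction (begin
      suc (suc k)       ≡⟨ v∈k+2 ⟨
      residue v         ≡⟨ cong residue (left v) ⟨
      residue (σ⁻¹ (σ v)) ≡⟨ fixes-k (inverse a) (inverse-colour-preserving a preserving) (σ v) σv∈k ⟩
      k                 ∎) (<⇒≢ (<-trans (n<1+n k) (n<1+n (suc k))) ∘ sym)
      where
      open ≡-Reasoning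
      σv∈k : residue (σ v) ≡ k
      σv∈k = next≡suc⇒≡ (residue<p (σ v)) (trans (sym σw≡next-σv) σw∈k+1)

  fixes-residue : ∀ k → k < p → FixesResidue k
  fixes-residue 0 _ = fixes-residue-0
  fixes-residue 1 _ = fixes-residue-1
  fixes-residue (suc (suc k)) k+2<p = fixes-residue-+2
    (fixes-residue k (<-trans (<-trans (n<1+n k) (n<1+n (suc k))) k+2<p))
    (fixes-residue (suc k) (<-trans (n<1+n (suc k)) k+2<p)) k+2<p

  colouring-distinguishing : IsDistinguishing (C m p) (m + 1) colouring
  colouring-distinguishing a nontrivial preserving = nontrivial λ v → same-fibre-same-label
    (toℕ-injective (fixes-residue (residue v) (residue<p v) a preserving v refl))
    (labelOf-σ a preserving v)
    where
    open Automorphism a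
    same-fibre-same-label : ∀ {u v} → fibre u ≡ fibre v → labelOf u ≡ labelOf v → u ≡ v
    same-fibre-same-label {u} {v} fu≡fv same-label = fibre-level-injective fu≡fv level≡
      where
      level≡ : level u ≡ level v
      level≡ = toℕ-injective (label-injective (residue u) (toℕ<n (level u)) (toℕ<n (level v))
        (trans same-label (cong (λ k → label k (toℕ (level v))) (cong toℕ (sym fu≡fv)))))

theorem3 : (m p : ℕ) → 2 ≤ p → p ≢ 4 → 2 ≤ m → .{{nz : NonZero (m * p)}} →
    DistinguishingNumberIs (C m p) (m + 1)
theorem3 (suc (suc m-2)) (suc (suc p-2)) (s≤s (s≤s z≤n)) p≢4 (s≤s (s≤s z≤n)) =
  (colouring , colouring-distinguishing) , no-distinguishing-below rotation-of-Cₚ rotate-moves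
  where open DistinguishingColouring m-2 p-2 p≢4
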